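{- Let $G$ be a graph and $v\in V(G)$. Then $\gamma_g^{t\,\prime}(G)\leq \gamma_g^{t\,\prime}(G-v)+4$.
   Context: Graphs are finite and simple. Total domination game on a graph $G$: Dominator and Staller alternately choose vertices; a vertex is totally dominated once one of its neighbors has been chosen; a vertex may be chosen only if it has at least one not yet totally dominated neighbor; the game ends when no legal move remains; Dominator aims to minimize and Staller to maximize the number of moves. $\gamma_g^{t\,\prime}(G)$ is the number of moves under optimal play when Staller moves first. $G-v$ is the graph obtained by deleting $v$ and its incident edges. -}

module Defs where

open import Data.Nat using (ℕ; zero; suc; _⊔_; _⊓_)
open import Data.Bool using (Bool; true; false; _∧_; _∨_; not)
open import Data.Fin using (Fin; punchIn)
open import Data.List using (List; []; _∷_; map; foldr; allFin; filterᵇ)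
open import Data.Bool.ListAction using (any)
open import Relation.Binary.PropositionalEquality using (_≡_)

record Graph (n : ℕ) : Set where
  field
    adj    : Fin n → Fin n → Bool
    sym    : ∀ u v → adj u v ≡ adj v u
    irrefl : ∀ v → adj v v ≡ false
open Graph public

deleteVertex : ∀ {n} → Graph (suc n) → Fin (suc n) → Graph n
deleteVertex G v = record
  { adj    = λ i j → adj G (punchIn v i) (punchIn v j)
  ; sym    = λ i j → sym G (punchIn v i) (punchIn v j)
  ; irrefl = λ i → irrefl G (punchIn v i)
  }

-- Game state: the set of vertices already totally dominated
-- (a vertex is totally dominated iff one of its neighbours has been chosen).
State : ℕ → Set
State n = Fin n → Bool

data Player : Set where
  Dominator Staller : Player

other : Player → Player
other Dominator = Staller
other Staller   = Dominator

legal : ∀ {n} → Graph n → State n → Fin n → Bool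
legal {n} G D v = any (λ u → adj G v u ∧ not (D u)) (allFin n)

legalMoves : ∀ {n} → Graph n → State n → List (Fin n)
legalMoves {n} G D = filterᵇ (legal G D) (allFin n)

play : ∀ {n} → Graph n → State n → Fin n → State n
play G D v u = D u ∨ adj G v u

opt : Player → ℕ → List ℕ → ℕ
opt Dominator x xs = foldr _⊓_ x xs
opt Staller   x xs = foldr _⊔_ x xs

-- Every legal move strictly enlarges
-- the set of totally dominated vertices, so at most n moves remain from the
-- empty state; fuel n is therefore never exhausted prematurely.
value : ∀ {n} → Graph n → ℕ → State n → Player → ℕ
value G zero       D p = 0
value G (suc fuel) D p with legalMoves G D
... | []     = 0
... | m ∷ ms = suc (opt p (f m) (map f ms))
  where
    f : _ → ℕ
    f v = value G fuel (play G D v) (other p)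

gammaTGStaller : ∀ {n} → Graph n → ℕ
gammaTGStaller {n} G = value G n (λ _ → false) Staller

module Submission where

-- The proof is an imagination strategy for Dominator.  A real game is played
-- on G while Dominator imagines a game on H = G - v.  The real state R
-- covers the imagined state I when every vertex totally dominated in I is
-- totally dominated in R.  Dominator copies his optimal imagined replies, and
-- Staller's real moves are copied into the imagined game whenever they are
-- legal there.  The only real moves without an imagined counterpart are v
-- itself and moves that totally dominate v.  The events "v becomes totally
-- dominated" and "v can no longer be played" each cost at most two extra real
-- moves, which gives the bounds +0 (v settled), +2 (v totally dominated) and
-- +4 (in general).

open import Defs
open import Data.Bool using (Bool; true; false; T; not)
open import Data.Bool.Properties using (T-∧; T-∨)
open import Data.Empty using (⊥-elim)
open import Data.Unit using (⊤; tt)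
open import Data.Nat using (ℕ; zero; suc; _≤_; _<_; _+_; _⊓_; _⊔_; z≤n; s≤s)
open import Data.Nat.Properties
  using (≤-refl; ≤-trans; ≤-reflexive; ≤-pred; n≮0; m≤n+m; m≤n⇒m⊓o≤n; m≤n⇒o⊓m≤n;
         m≤n⇒m≤n⊔o; m≤n⇒m≤o⊔n; ⊓-sel; ⊔-sel; +-comm; +-assoc; +-identityʳ; +-mono-≤;
         +-monoˡ-≤; +-monoʳ-≤; +-mono-<-≤; +-mono-≤-<; module ≤-Reasoning)
open import Data.Fin as Fin using (Fin; punchIn; punchOut)
open import Data.Fin.Properties using (any?; punchIn-punchOut)
open import Data.List using ([]; _∷_; map; foldr; allFin)
open import Data.List.Properties using (foldr-preservesᵒ)
open import Data.List.Membership.Propositional using (_∈_; lose)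
open import Data.List.Membership.Propositional.Properties
  using (∈-allFin; ∈-filter⁺; ∈-filter⁻; ∈-map⁺; ∈-map⁻; foldr-selective)
open import Data.List.Relation.Unary.Any as Any using (here; there; satisfied)
open import Data.List.Relation.Unary.Any.Properties using (any⁺; any⁻)
open import Data.Product using (∃; _×_; _,_; proj₂)
open import Data.Sum using (_⊎_; inj₁; inj₂; [_,_]′)
open import Function.Bundles using (Equivalence)
open import Relation.Nullary using (¬_; Dec; yes; no; contradiction)
open import Relation.Nullary.Decidable using (T?; decidable-stable)
open import Relation.Binary.PropositionalEquality
  using (_≡_; refl; cong; subst) renaming (sym to ≡-sym)

opt-∈ : ∀ p a as → opt p a as ∈ a ∷ as
opt-∈ Dominator a as = [ here , there ]′ (foldr-selective ⊓-sel a as)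
opt-∈ Staller   a as = [ here , there ]′ (foldr-selective ⊔-sel a as)

min-≤ : ∀ {y} a as → y ∈ a ∷ as → foldr _⊓_ a as ≤ y
min-≤ {y} a as y∈ = foldr-preservesᵒ ⊓-≤ a as (candidate y∈)
  where
    ⊓-≤ : ∀ x z → x ≤ y ⊎ z ≤ y → x ⊓ z ≤ y
    ⊓-≤ x z = [ m≤n⇒m⊓o≤n z , m≤n⇒o⊓m≤n x ]′
    candidate : y ∈ a ∷ as → a ≤ y ⊎ Any.Any (_≤ y) as
    candidate (here refl) = inj₁ ≤-refl
    candidate (there y∈as) = inj₂ (Any.map (λ { refl → ≤-refl }) y∈as)

≤-max : ∀ {y} a as → y ∈ a ∷ as → y ≤ foldr _⊔_ a as
≤-max {y} a as y∈ = foldr-preservesᵒ ≤-⊔ a as (candidate y∈)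
  where
    ≤-⊔ : ∀ x z → y ≤ x ⊎ y ≤ z → y ≤ x ⊔ z
    ≤-⊔ x z = [ m≤n⇒m≤n⊔o z , m≤n⇒m≤o⊔n x ]′
    candidate : y ∈ a ∷ as → y ≤ a ⊎ Any.Any (y ≤_) as
    candidate (here refl) = inj₁ ≤-refl
    candidate (there y∈as) = inj₂ (Any.map (λ { refl → ≤-refl }) y∈as)

_⊆_ : ∀ {n} → State n → State n → Set
A ⊆ B = ∀ u → T (A u) → T (B u)

⊆-trans : ∀ {n} {A B C : State n} → A ⊆ B → B ⊆ C → A ⊆ C
⊆-trans A⊆B B⊆C u t = B⊆C u (A⊆B u t)

T-not : ∀ {b} → ¬ T b → T (not b)
T-not {false} _ = _
T-not {true} ¬t = ¬t _

not-T : ∀ {b} → T (not b) → ¬ T b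
not-T {false} _ ()

-- The number of vertices not yet totally dominated; it bounds the length of
-- the remaining game, which is what makes the fuel in `value` sufficient.
unmarked : Bool → ℕ
unmarked true  = 0
unmarked false = 1

undominated : ∀ {n} → State n → ℕ
undominated {zero}  D = 0
undominated {suc n} D = unmarked (D Fin.zero) + undominated (λ u → D (Fin.suc u))

unmarked-≤ : ∀ {a b} → (T a → T b) → unmarked b ≤ unmarked a
unmarked-≤ {true}  {true}  _   = z≤n
unmarked-≤ {true}  {false} a⇒b = ⊥-elim (a⇒b _)
unmarked-≤ {false} {true}  _   = z≤n
unmarked-≤ {false} {false} _   = ≤-refl

unmarked-< : ∀ {a b} → ¬ T a → T b → unmarked b < unmarked a
unmarked-< {true}          ¬a _ = contradiction _ ¬a
unmarked-< {false} {true}  _  _ = s≤s z≤n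

undominated-mono : ∀ {n} {A B : State n} → A ⊆ B → undominated B ≤ undominated A
undominated-mono {zero}  _   = z≤n
undominated-mono {suc n} A⊆B =
  +-mono-≤ (unmarked-≤ (A⊆B Fin.zero)) (undominated-mono (λ u → A⊆B (Fin.suc u)))

undominated-< : ∀ {n} {A B : State n} → A ⊆ B → ∀ u → ¬ T (A u) → T (B u) →
  undominated B < undominated A
undominated-< {suc n} A⊆B Fin.zero ¬a b =
  +-mono-<-≤ (unmarked-< ¬a b) (undominated-mono (λ u → A⊆B (Fin.suc u)))
undominated-< {suc n} A⊆B (Fin.suc u) ¬a b =
  +-mono-≤-< (unmarked-≤ (A⊆B Fin.zero)) (undominated-< (λ w → A⊆B (Fin.suc w)) u ¬a b)

undominated-empty : ∀ n → undominated {n} (λ _ → false) ≡ n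
undominated-empty zero    = refl
undominated-empty (suc n) = cong suc (undominated-empty n)

module _ {n : ℕ} (G : Graph n) where

  adj-sym : ∀ {x u} → T (adj G x u) → T (adj G u x)
  adj-sym {x} {u} = subst T (sym G x u)

  adj-irrefl : ∀ {x} → ¬ T (adj G x x)
  adj-irrefl {x} = subst T (irrefl G x)

  legal⁺ : ∀ {D x u} → T (adj G x u) → ¬ T (D u) → T (legal G D x)
  legal⁺ {u = u} a d = any⁺ _ (lose (∈-allFin u) (Equivalence.from T-∧ (a , T-not d)))

  legal⁻ : ∀ {D x} → T (legal G D x) → ∃ λ u → T (adj G x u) × ¬ T (D u)
  legal⁻ l with satisfied (any⁻ _ (allFin n) l)
  ... | u , t with Equivalence.to T-∧ t
  ...   | a , d = u , a , not-T d

  legal-anti : ∀ {A B x} → A ⊆ B → T (legal G B x) → T (legal G A x)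
  legal-anti {A} A⊆B l with legal⁻ l
  ... | u , a , d = legal⁺ {D = A} a (λ t → d (A⊆B u t))

  illegal-closed : ∀ {D x u} → ¬ T (legal G D x) → T (adj G x u) → T (D u)
  illegal-closed ¬l a = decidable-stable (T? _) (λ d → ¬l (legal⁺ a d))

  play-⊇ : ∀ D x → D ⊆ play G D x
  play-⊇ D x u t = Equivalence.from T-∨ (inj₁ t)

  play-adj : ∀ {D x u} → T (adj G x u) → T (play G D x u)
  play-adj a = Equivalence.from T-∨ (inj₂ a)

  play-undominated : ∀ {D x u} → ¬ T (D u) → ¬ T (adj G x u) → ¬ T (play G D x u)
  play-undominated d ¬a t = [ d , ¬a ]′ (Equivalence.to T-∨ t)

  played-illegal : ∀ {D x} → ¬ T (legal G (play G D x) x)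
  played-illegal {D} l with legal⁻ l
  ... | u , a , d = d (play-adj {D = D} a)

  moves? : ∀ D → Dec (∃ λ x → T (legal G D x))
  moves? D = any? (λ x → T? (legal G D x))

  ∈-legalMoves⁺ : ∀ {D x} → T (legal G D x) → x ∈ legalMoves G D
  ∈-legalMoves⁺ l = ∈-filter⁺ (λ y → T? (legal G _ y)) (∈-allFin _) l

  ∈-legalMoves⁻ : ∀ {D} x → x ∈ legalMoves G D → T (legal G D x)
  ∈-legalMoves⁻ {D} x x∈ = proj₂ (∈-filter⁻ (λ y → T? (legal G D y)) {xs = allFin n} x∈)

  after : ℕ → State n → Player → Fin n → ℕ
  after f D p x = value G f (play G D x) (other p)

  value-over : ∀ {f D p} → ¬ (∃ λ x → T (legal G D x)) → value G f D p ≡ 0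
  value-over {zero} _ = refl
  value-over {suc f} {D} over with legalMoves G D | ∈-legalMoves⁻ {D}
  ... | []    | _   = refl
  ... | m ∷ _ | mem = contradiction (m , mem m (here refl)) over

  value-over-≤ : ∀ {f D p K} → ¬ (∃ λ x → T (legal G D x)) → value G f D p ≤ K
  value-over-≤ {f} {D} {p} {K} over = subst (_≤ K) (≡-sym (value-over {f} {D} {p} over)) z≤n

  -- Otherwise the mover's optimum is attained at a legal move, so any property
  -- of all the values 1 + after x, for legal x, holds of the value.
  value-∀ : ∀ (Q : ℕ → Set) {f D p x₀} → T (legal G D x₀) →
    (∀ x → T (legal G D x) → Q (suc (after f D p x))) → Q (value G (suc f) D p)
  value-∀ Q {f} {D} {p} l₀ h with legalMoves G D | ∈-legalMoves⁺ l₀ | ∈-legalMoves⁻ {D}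
  ... | m ∷ ms | _ | mem with ∈-map⁻ (after f D p) (opt-∈ p (after f D p m) (map (after f D p) ms))
  ...   | x , x∈ , eq = subst Q (cong suc (≡-sym eq)) (h x (mem x x∈))

  dominator-≤ : ∀ {f D x} → T (legal G D x) →
    value G (suc f) D Dominator ≤ suc (after f D Dominator x)
  dominator-≤ {f} {D} l with legalMoves G D | ∈-legalMoves⁺ l
  ... | m ∷ ms | x∈ = s≤s (min-≤ _ (map (after f D Dominator) ms) (∈-map⁺ (after f D Dominator) x∈))

  staller-≥ : ∀ {f D x} → T (legal G D x) →
    suc (after f D Staller x) ≤ value G (suc f) D Staller
  staller-≥ {f} {D} l with legalMoves G D | ∈-legalMoves⁺ l
  ... | m ∷ ms | x∈ = s≤s (≤-max _ (map (after f D Staller) ms) (∈-map⁺ (after f D Staller) x∈))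

  staller-≤ : ∀ {f D K} → (∀ x → T (legal G D x) → suc (after f D Staller x) ≤ K) →
    value G (suc f) D Staller ≤ K
  staller-≤ {f} {D} {K} h with moves? D
  ... | yes (x₀ , l₀) = value-∀ (_≤ K) l₀ h
  ... | no over = value-over-≤ over

  round-mono : ∀ {f f' D} p → (∀ x → T (legal G D x) → after f D p x ≤ after f' D p x) →
    value G (suc f) D p ≤ value G (suc f') D p
  round-mono {D = D} p le with moves? D
  round-mono {D = D} p le | no over = value-over-≤ over
  round-mono Staller   le | yes (x₀ , l₀) = staller-≤ (λ x l → ≤-trans (s≤s (le x l)) (staller-≥ l))
  round-mono Dominator le | yes (x₀ , l₀) =
    value-∀ (_ ≤_) l₀ (λ x l → ≤-trans (dominator-≤ l) (s≤s (le x l)))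

  fuel-mono : ∀ f D p → value G f D p ≤ value G (suc f) D p
  fuel-mono zero    D p = z≤n
  fuel-mono (suc f) D p = round-mono p (λ x _ → fuel-mono f (play G D x) (other p))

  -- Every legal move totally dominates a new vertex, so fuel f is already
  -- enough once at most f vertices are undominated.
  legal-progress : ∀ {D x} → T (legal G D x) → undominated (play G D x) < undominated D
  legal-progress {D} {x} l with legal⁻ l
  ... | u , a , d = undominated-< (play-⊇ D x) u d (play-adj {D = D} a)

  fuel-sufficient : ∀ f D p → undominated D ≤ f → value G (suc f) D p ≤ value G f D p
  fuel-sufficient zero D p bound =
    ≤-reflexive (value-over (λ { (x , l) → n≮0 (≤-trans (legal-progress l) bound) }))
  fuel-sufficient (suc f) D p bound =
    round-mono p (λ x l → fuel-sufficient f (play G D x) (other p)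
      (≤-pred (≤-trans (legal-progress l) bound)))

module Imagination {m k : ℕ} (G : Graph m) (H : Graph k) (ι : Fin k → Fin m)
                   (ι-adj : ∀ i j → adj H i j ≡ adj G (ι i) (ι j)) where

  record Covers (R : State m) (I : State k) : Set where
    constructor covers
    field covered : ∀ i → T (I i) → T (R (ι i))
  open Covers

  covers-⊆ : ∀ {R R' I} → Covers R I → R ⊆ R' → Covers R' I
  covers-⊆ cov R⊆R' = covers λ i t → R⊆R' (ι i) (covered cov i t)

  covers-play : ∀ {R I} → Covers R I → ∀ i → Covers (play G R (ι i)) (play H I i)
  covers-play {R} {I} cov i = covers dominated
    where
      dominated : ∀ j → T (play H I i j) → T (play G R (ι i) (ι j))
      dominated j t with Equivalence.to T-∨ t
      ... | inj₁ d = play-⊇ G R (ι i) (ι j) (covered cov j d)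
      ... | inj₂ a = play-adj G {D = R} (subst T (ι-adj i j) a)

  -- If ι i is illegal in the real game, its neighbourhood is already
  -- totally dominated there, so any real move keeps the covering.
  covers-illegal : ∀ {R I i} → Covers R I → ¬ T (legal G R (ι i)) →
    ∀ x → Covers (play G R x) (play H I i)
  covers-illegal {R} {I} {i} cov ¬l x = covers dominated
    where
      dominated : ∀ j → T (play H I i j) → T (play G R x (ι j))
      dominated j t with Equivalence.to T-∨ t
      ... | inj₁ d = play-⊇ G R x (ι j) (covered cov j d)
      ... | inj₂ a = play-⊇ G R x (ι j) (illegal-closed G ¬l (subst T (ι-adj i j) a))

  legal-lift : ∀ {R I i j} → Covers R I → T (adj G (ι i) (ι j)) → ¬ T (R (ι j)) →
    T (legal H I i)
  legal-lift {I = I} {i} {j} cov a d =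
    legal⁺ H {D = I} (subst T (≡-sym (ι-adj i j)) a) (λ t → d (covered cov j t))

  -- Dominator copies his imagined reply i when ι i is legal in the real game,
  -- and otherwise plays any legal real move; both keep the covering, so a
  -- bound on the Staller-to-move continuations lifts to the current position.
  dominator-copies : ∀ {f c R I x₀ i₀} → Covers R I →
    T (legal G R x₀) → T (legal H I i₀) →
    (∀ {R' I'} → R ⊆ R' → Covers R' I' → value G f R' Staller ≤ value H f I' Staller + c) →
    value G (suc f) R Dominator ≤ value H (suc f) I Dominator + c
  dominator-copies {f} {c} {R} {I} {x₀} cov l₀ h₀ bound = value-∀ H (λ t → _ ≤ t + c) h₀ reply
    where
      reply : ∀ i → T (legal H I i) →
        value G (suc f) R Dominator ≤ suc (value H f (play H I i) Staller) + c
      reply i _ with T? (legal G R (ι i))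
      ... | yes l = ≤-trans (dominator-≤ G l) (s≤s (bound (play-⊇ G R (ι i)) (covers-play cov i)))
      ... | no ¬l =
        ≤-trans (dominator-≤ G l₀) (s≤s (bound (play-⊇ G R x₀) (covers-illegal cov ¬l x₀)))

  staller-copied : ∀ {f c R I i} → T (legal H I i) →
    value G f (play G R (ι i)) Dominator ≤ value H f (play H I i) Dominator + c →
    suc (value G f (play G R (ι i)) Dominator) ≤ value H (suc f) I Staller + c
  staller-copied {c = c} h bound = ≤-trans (s≤s bound) (+-monoˡ-≤ c (staller-≥ H h))

  transfer : (P : State m → Set) → (∀ {R R'} → R ⊆ R' → P R → P R') →
    (∀ {R I x} → P R → Covers R I → T (legal G R x) → ∃ λ i → x ≡ ι i × T (legal H I i)) →
    ∀ f {R I} → P R → Covers R I → ∀ p → value G f R p ≤ value H f I p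
  transfer P P-⊆ copy f pR cov p = ≤-trans (go f pR cov p) (≤-reflexive (+-identityʳ _))
    where
      go : ∀ f {R I} → P R → Covers R I → ∀ p → value G f R p ≤ value H f I p + 0
      go zero _ _ _ = z≤n
      go (suc f) {R} {I} pR cov Staller = staller-≤ G reply
        where
          reply : ∀ x → T (legal G R x) →
            suc (after G f R Staller x) ≤ value H (suc f) I Staller + 0
          reply x l with copy pR cov l
          ... | i , refl , h =
            staller-copied h (go f (P-⊆ (play-⊇ G R x) pR) (covers-play cov i) Dominator)
      go (suc f) {R} pR cov Dominator with moves? G R
      ... | no over = value-over-≤ G over
      ... | yes (x₀ , l₀) with copy pR cov l₀
      ...   | i₀ , refl , h₀ =
        dominator-copies cov l₀ h₀ (λ R⊆R' cov' → go f (P-⊆ R⊆R' pR) cov' Staller)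

module _ {n : ℕ} (G : Graph n) where
  open Imagination G G (λ x → x) (λ _ _ → refl)

  continuation : ∀ f {A B : State n} → A ⊆ B → ∀ p → value G f B p ≤ value G f A p
  continuation f A⊆B = transfer (λ _ → ⊤) (λ _ _ → tt) copy f tt (covers A⊆B)
    where
      copy : ∀ {R I x} → ⊤ → Covers R I → T (legal G R x) → ∃ λ i → x ≡ i × T (legal G I i)
      copy {x = x} _ cov l with legal⁻ G l
      ... | _ , a , d = x , refl , legal-lift cov a d

  -- Letting Dominator start costs at most one move more than letting Staller
  -- start: his first move only helps Staller's game.
  dominator-first-≤ : ∀ f D → value G f D Dominator ≤ suc (value G f D Staller)
  dominator-first-≤ zero    D = z≤n
  dominator-first-≤ (suc f) D with moves? G D
  ... | no over = value-over-≤ G over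
  ... | yes (x , l) = begin
    value G (suc f) D Dominator          ≤⟨ dominator-≤ G l ⟩
    suc (value G f (play G D x) Staller) ≤⟨ s≤s (continuation f (play-⊇ G D x) Staller) ⟩
    suc (value G f D Staller)            ≤⟨ s≤s (fuel-mono G f D Staller) ⟩
    suc (value G (suc f) D Staller)      ∎
    where open ≤-Reasoning

module Deletion {n : ℕ} (G : Graph (suc n)) (v : Fin (suc n)) where

  H : Graph n
  H = deleteVertex G v

  ι : Fin n → Fin (suc n)
  ι = punchIn v

  open Imagination G H ι (λ _ _ → refl) public

  data Vertex : Fin (suc n) → Set where
    is-v     : Vertex v
    image-of : ∀ i → Vertex (ι i)

  vertex : ∀ x → Vertex x
  vertex x with v Fin.≟ x
  ... | yes refl = is-v
  ... | no v≢x   = subst Vertex (punchIn-punchOut v≢x) (image-of (punchOut v≢x))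

  data RealMove (R : State (suc n)) (I : State n) : Fin (suc n) → Set where
    plays-v     : RealMove R I v
    copyable    : ∀ i → T (legal H I i) → RealMove R I (ι i)
    dominates-v : ∀ i → T (adj G (ι i) v) → ¬ T (R v) → RealMove R I (ι i)

  classify : ∀ {R I x} → Covers R I → T (legal G R x) → RealMove R I x
  classify {x = x} cov l with vertex x
  ... | is-v = plays-v
  ... | image-of i with legal⁻ G l
  ...   | u , a , d with vertex u
  ...     | is-v       = dominates-v i a d
  ...     | image-of j = copyable i (legal-lift cov a d)

  Over : State n → Set
  Over I = ¬ (∃ λ i → T (legal H I i))

  Bound : ℕ → ℕ → Set
  Bound c f = ∀ {R I} → Covers R I → ∀ p → value G f R p ≤ value H f I p + c

  Settled : State (suc n) → Set
  Settled R = T (R v) × ¬ T (legal G R v)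

  playing-v-settles : ∀ {R} → T (R v) → Settled (play G R v)
  playing-v-settles {R} dv = play-⊇ G R v v dv , played-illegal G

  -- Once v is settled, every legal real move can be copied: no extra moves.
  settled-bound : ∀ f {R I} → Settled R → Covers R I → ∀ p → value G f R p ≤ value H f I p
  settled-bound = transfer Settled settled-⊆ copy
    where
      settled-⊆ : ∀ {R R'} → R ⊆ R' → Settled R → Settled R'
      settled-⊆ R⊆R' (dv , ¬lv) = R⊆R' v dv , λ l → ¬lv (legal-anti G R⊆R' l)
      copy : ∀ {R I x} → Settled R → Covers R I → T (legal G R x) →
        ∃ λ i → x ≡ ι i × T (legal H I i)
      copy (dv , ¬lv) cov l with classify cov l
      ... | plays-v             = contradiction l ¬lv
      ... | copyable i h        = i , refl , h
      ... | dominates-v _ _ ¬dv = contradiction dv ¬dv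

  -- Staller playing the totally dominated vertex v settles it, at the cost of
  -- his move and of Dominator losing the initiative.
  staller-plays-dominated-v : ∀ f {R I} → T (R v) → Covers R I →
    suc (value G f (play G R v) Dominator) ≤ value H (suc f) I Staller + 2
  staller-plays-dominated-v f {R} {I} dv cov = begin
    suc (value G f R' Dominator)     ≤⟨ s≤s (dominator-first-≤ G f R') ⟩
    suc (suc (value G f R' Staller)) ≤⟨ s≤s (s≤s (settled-bound f (playing-v-settles dv)
                                          (covers-⊆ cov (play-⊇ G R v)) Staller)) ⟩
    suc (suc (value H f I Staller))  ≤⟨ s≤s (s≤s (fuel-mono H f I Staller)) ⟩
    2 + value H (suc f) I Staller    ≡⟨ +-comm 2 _ ⟩
    value H (suc f) I Staller + 2    ∎
    where
      R' : State (suc n)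
      R' = play G R v
      open ≤-Reasoning

  dominated-bound : ∀ f {R I} → T (R v) → Covers R I → ∀ p → value G f R p ≤ value H f I p + 2
  dominated-bound zero _ _ _ = z≤n
  dominated-bound (suc f) {R} {I} dv cov Staller = staller-≤ G reply
    where
      reply : ∀ x → T (legal G R x) → suc (after G f R Staller x) ≤ value H (suc f) I Staller + 2
      reply x l with classify cov l
      ... | plays-v             = staller-plays-dominated-v f dv cov
      ... | copyable i h        =
        staller-copied h (dominated-bound f (play-⊇ G R (ι i) v dv) (covers-play cov i) Dominator)
      ... | dominates-v _ _ ¬dv = contradiction dv ¬dv
  dominated-bound (suc f) {R} {I} dv cov Dominator with moves? G R | moves? H I
  ... | no over       | _             = value-over-≤ G over
  ... | yes (x₀ , l₀) | yes (i₀ , h₀) =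
    dominator-copies cov l₀ h₀ (λ R⊆R' cov' → dominated-bound f (R⊆R' v dv) cov' Staller)
  ... | yes (x₀ , l₀) | no overH with classify cov l₀
  ...   | copyable i h        = contradiction (i , h) overH
  ...   | dominates-v _ _ ¬dv = contradiction dv ¬dv
  ...   | plays-v             = begin
    value G (suc f) R Dominator          ≤⟨ dominator-≤ G l₀ ⟩
    suc (value G f (play G R v) Staller) ≤⟨ s≤s (settled-bound f (playing-v-settles dv)
                                              (covers-⊆ cov (play-⊇ G R v)) Staller) ⟩
    suc (value H f I Staller)            ≡⟨ cong suc (value-over H {f} {I} {Staller} overH) ⟩
    1                                    ≤⟨ m≤n+m 1 1 ⟩
    2                                    ≤⟨ m≤n+m 2 _ ⟩
    value H (suc f) I Dominator + 2      ∎
    where open ≤-Reasoning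

  dominated-over : ∀ f {R I} → T (R v) → Covers R I → Over I → ∀ p → value G f R p ≤ 2
  dominated-over f {R} {I} dv cov overH p =
    subst (λ t → value G f R p ≤ t + 2) (value-over H {f} {I} {p} overH)
      (dominated-bound f dv cov p)

  two-extra : ∀ {f a I} → a ≤ value H f I Staller + 2 → suc (suc a) ≤ value H (suc f) I Staller + 4
  two-extra {f} {a} {I} a≤ = begin
    2 + a                         ≤⟨ +-monoʳ-≤ 2 a≤ ⟩
    2 + (value H f I Staller + 2) ≡⟨ +-comm 2 _ ⟩
    value H f I Staller + 2 + 2   ≡⟨ +-assoc _ 2 2 ⟩
    value H f I Staller + 4       ≤⟨ +-monoˡ-≤ 4 (fuel-mono H f I Staller) ⟩
    value H (suc f) I Staller + 4 ∎
    where open ≤-Reasoning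

  -- If Staller plays the undominated vertex v, Dominator answers with a
  -- neighbour u of v (legal, as v is still undominated), which totally
  -- dominates v; the two extra moves use up the slack between +2 and +4.
  staller-plays-undominated-v : ∀ f {R I} → ¬ T (R v) → Covers R I → T (legal G R v) →
    suc (value G f (play G R v) Dominator) ≤ value H (suc f) I Staller + 4
  staller-plays-undominated-v f {R} {I} ¬dv cov l with legal⁻ G l
  ... | u , a , _ = begin
    suc (value G f R' Dominator)                 ≤⟨ s≤s (fuel-mono G f R' Dominator) ⟩
    suc (value G (suc f) R' Dominator)           ≤⟨ s≤s (dominator-≤ G u-legal) ⟩
    suc (suc (value G f (play G R' u) Staller))  ≤⟨ two-extra (dominated-bound f v-dominated
                                                      (covers-⊆ cov R⊆R'') Staller) ⟩
    value H (suc f) I Staller + 4                ∎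
    where
      R' : State (suc n)
      R' = play G R v
      u-legal : T (legal G R' u)
      u-legal = legal⁺ G {D = R'} (adj-sym G a) (play-undominated G {D = R} ¬dv (adj-irrefl G))
      v-dominated : T (play G R' u v)
      v-dominated = play-adj G {D = R'} (adj-sym G a)
      R⊆R'' : R ⊆ play G R' u
      R⊆R'' = ⊆-trans (play-⊇ G R v) (play-⊇ G R' u)
      open ≤-Reasoning

  staller-undominated-v : ∀ f {R I} → ¬ T (R v) → Covers R I → Bound 4 f →
    value G (suc f) R Staller ≤ value H (suc f) I Staller + 4
  staller-undominated-v f {R} {I} ¬dv cov bound = staller-≤ G reply
    where
      reply : ∀ x → T (legal G R x) → suc (after G f R Staller x) ≤ value H (suc f) I Staller + 4
      reply x l with classify cov l
      ... | plays-v          = staller-plays-undominated-v f ¬dv cov l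
      ... | copyable i h     = staller-copied h (bound (covers-play cov i) Dominator)
      ... | dominates-v i a _ =
        ≤-trans (s≤s (dominator-first-≤ G f (play G R (ι i))))
                (two-extra (dominated-bound f (play-adj G {D = R} a)
                                              (covers-⊆ cov (play-⊇ G R (ι i))) Staller))

  -- With the imagined game over, Dominator playing v leaves Staller only
  -- moves that totally dominate v, each followed by at most two moves.
  dominator-plays-v : ∀ f {R I} → Covers R I → Over I → value G f (play G R v) Staller ≤ 3
  dominator-plays-v zero _ _ = z≤n
  dominator-plays-v (suc f) {R} {I} cov overH = staller-≤ G reply
    where
      R' : State (suc n)
      R' = play G R v
      reply : ∀ y → T (legal G R' y) → suc (after G f R' Staller y) ≤ 3
      reply y l with classify (covers-⊆ cov (play-⊇ G R v)) l
      ... | plays-v           = contradiction l (played-illegal G)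
      ... | copyable i h      = contradiction (i , h) overH
      ... | dominates-v i a _ =
        s≤s (dominated-over f (play-adj G {D = R'} a)
               (covers-⊆ cov (⊆-trans (play-⊇ G R v) (play-⊇ G R' (ι i)))) overH Dominator)

  -- Dominator to move while v is undominated: he copies while the imagined
  -- game lasts; once it is over, any legal real move leaves at most three more.
  dominator-undominated-v : ∀ f {R I} → Covers R I → Bound 4 f →
    value G (suc f) R Dominator ≤ value H (suc f) I Dominator + 4
  dominator-undominated-v f {R} {I} cov bound with moves? G R | moves? H I
  ... | no over       | _             = value-over-≤ G over
  ... | yes (x₀ , l₀) | yes (i₀ , h₀) = dominator-copies cov l₀ h₀ (λ _ cov' → bound cov' Staller)
  ... | yes (x₀ , l₀) | no overH      =
    ≤-trans (dominator-≤ G l₀) (≤-trans (s≤s (after-x₀ (classify cov l₀))) (m≤n+m 4 _))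
    where
      after-x₀ : ∀ {x} → RealMove R I x → value G f (play G R x) Staller ≤ 3
      after-x₀ plays-v             = dominator-plays-v f cov overH
      after-x₀ (copyable i h)      = contradiction (i , h) overH
      after-x₀ (dominates-v i a _) =
        ≤-trans (dominated-over f (play-adj G {D = R} a) (covers-⊆ cov (play-⊇ G R (ι i)))
                                overH Staller)
                (m≤n+m 2 1)

  deletion-bound : ∀ f → Bound 4 f
  deletion-bound zero    _ _ = z≤n
  deletion-bound (suc f) {R} cov p with T? (R v) | p
  ... | yes dv  | q         = ≤-trans (dominated-bound (suc f) dv cov q) (+-monoʳ-≤ _ (m≤n+m 2 2))
  ... | no ¬dv  | Staller   = staller-undominated-v f ¬dv cov (deletion-bound f)
  ... | no _    | Dominator = dominator-undominated-v f cov (deletion-bound f)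

-- Both games start from the empty state; the fuel n + 1 used for G - v can
-- be cut to n because G - v has only n vertices.
proposition4p2 : ∀ {n} (G : Graph (suc n)) (v : Fin (suc n)) →
    gammaTGStaller G ≤ gammaTGStaller (deleteVertex G v) + 4
proposition4p2 {n} G v = begin
  value G (suc n) empty Staller     ≤⟨ deletion-bound (suc n) (covers (λ _ ())) Staller ⟩
  value H (suc n) empty Staller + 4 ≤⟨ +-monoˡ-≤ 4 (fuel-sufficient H n empty Staller
                                                      (≤-reflexive (undominated-empty n))) ⟩
  value H n empty Staller + 4       ∎
  where
    open Deletion G v
    open ≤-Reasoning
    empty : ∀ {m} → State m
    empty _ = false
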